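{- Let $t\ge1$ and let $p_1,\dots,p_t$ be positive integers; set $d_k=\sum_{i=1}^k p_i + k$ for $1\le k\le t$. Then there is a polynomial of degree $d_t$ with zero constant coefficient agreeing with $F_{p_1,\dots,p_t}$ on $\mathbb{N}$, and for $0\le i<d_t$ its coefficient of $n^{d_t-i}$ equals $$\sum_{j_{t-1} = 0}^{\min(j_t, d_{t-1}-1)}\ \sum_{j_{t-2}=0}^{\min(j_{t-1}, d_{t-2}-1)}\cdots\sum_{j_1 = 0}^{\min(j_2,d_1 - 1)}\ \prod_{k=1}^t \binom{d_k - j_{k-1}}{j_k - j_{k-1}}\frac{B_{j_k - j_{k-1}}}{d_k - j_{k-1}},$$ where $j_t = i$ and $j_0 = 0$.
   Context: For $n\in\mathbb{N}$, $F_{p_1,\dots,p_t}(n)=\sum_{0\le k_1<\dots<k_t\le n-1}k_1^{p_1}\cdots k_t^{p_t}$ (equal to $0$ if $t>n$). $B_j$ are the Bernoulli numbers with the convention $B_1=-1/2$. For $t=1$ there are no summations. -}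

module Defs where

open import Data.Nat as ℕ using (ℕ; zero; suc; _∸_; _⊓_)
open import Data.Nat.Combinatorics using (_C_)
open import Data.Integer using (+_)
open import Data.Rational using (ℚ; 0ℚ; 1ℚ; _/_; _+_; _*_; -_)
open import Data.List using (List; []; _∷_; _++_; length)

σℕ : (ℕ → ℕ) → ℕ → ℕ
σℕ f zero    = 0
σℕ f (suc n) = σℕ f n ℕ.+ f n

σ : (ℕ → ℚ) → ℕ → ℚ
σ f zero    = 0ℚ
σ f (suc n) = σ f n + f n

toℚ : ℕ → ℚ
toℚ n = (+ n) / 1

_^ℚ_ : ℚ → ℕ → ℚ
x ^ℚ zero  = 1ℚ
x ^ℚ suc k = x * (x ^ℚ k)

-- 1/n for n ≥ 1 (only ever applied to nonzero arguments below; 0 ↦ 0 as a dummy)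
inv : ℕ → ℚ
inv zero    = 0ℚ
inv (suc n) = (+ 1) / suc n

-- Bernoulli numbers, convention B₁ = -1/2:
--   B₀ = 1,  B_m = - 1/(m+1) Σ_{k=0}^{m-1} C(m+1,k) B_k  (m ≥ 1)

nth : List ℚ → ℕ → ℚ
nth []       _       = 0ℚ
nth (x ∷ xs) zero    = x
nth (x ∷ xs) (suc k) = nth xs k

-- next value given the list [B₀,…,B_{m-1}] (m = length)
nextB : List ℚ → ℚ
nextB bs with length bs
... | zero  = 1ℚ
... | suc k = - (inv (suc (suc k)) * σ (λ j → toℚ (suc (suc k) C j) * nth bs j) (suc k))

Bs : ℕ → List ℚ
Bs zero    = []
Bs (suc n) = Bs n ++ (nextB (Bs n) ∷ [])

B : ℕ → ℚ
B m = nth (Bs (suc m)) m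

-- F_{p_1,…,p_t}(n) = Σ_{0 ≤ k_1 < … < k_t ≤ n-1} k_1^{p_1} ⋯ k_t^{p_t},
-- with the exponents given as a function p : ℕ → ℕ (p i = p_i, 1 ≤ i ≤ t).
--
-- Fgen p i r m n = Σ_{m ≤ k_i < k_{i+1} < … < k_{i+r-1} ≤ n-1} Π_{l=i}^{i+r-1} k_l^{p_l}
Fgen : (ℕ → ℕ) → ℕ → ℕ → ℕ → ℕ → ℕ
Fgen p i zero    m n = 1
Fgen p i (suc r) m n =
  σℕ (λ j → (m ℕ.+ j) ℕ.^ p i ℕ.* Fgen p (suc i) r (suc (m ℕ.+ j)) n) (n ∸ m)

F : (ℕ → ℕ) → ℕ → ℕ → ℕ
F p t n = Fgen p 1 t 0 n

d : (ℕ → ℕ) → ℕ → ℕ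
d p zero    = 0
d p (suc k) = d p k ℕ.+ p (suc k) ℕ.+ 1

term : (ℕ → ℕ) → ℕ → ℕ → ℕ → ℚ
term p k a b = toℚ ((d p k ∸ a) C (b ∸ a)) * B (b ∸ a) * inv (d p k ∸ a)

-- S p k j_k = Σ_{j_{k-1}=0}^{min(j_k, d_{k-1}-1)} ⋯ Σ_{j_1=0}^{min(j_2,d_1-1)}
--               Π_{l=1}^{k} term p l j_{l-1} j_l ,   with j_0 = 0   (k ≥ 1)
S : (ℕ → ℕ) → ℕ → ℕ → ℚ
S p zero          j = 0ℚ   -- unused (k ≥ 1)
S p (suc zero)    j = term p 1 0 j
S p (suc (suc k)) j =
  σ (λ a → S p (suc k) a * term p (suc (suc k)) a j) (suc (j ⊓ (d p (suc k) ∸ 1)))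

evalPoly : (ℕ → ℚ) → ℕ → ℚ → ℚ
evalPoly c D x = σ (λ k → c k * (x ^ℚ k)) (suc D)

-- Conditioning on the largest index gives F_{p₁…p_{t+1}}(n) = Σ_{k<n} F_{p₁…p_t}(k) k^{p_{t+1}}.
-- If F_{p₁…p_t}(k) = Σ_{a<d_t} S_t(a) k^{d_t−a}, Faulhaber's formula
-- Σ_{k<n} k^m = (1/(m+1)) Σ_{j≤m} C(m+1,j) B_j n^{m+1−j} turns the a-th term into a polynomial of
-- degree d_{t+1} − a, and collecting the coefficient of n^{d_{t+1}−i} over the triangle a ≤ i yields
-- exactly the recursion by which S_{t+1} is built from S_t. The leading coefficient S_t(0) = Π_k 1/d_k
-- is positive. Faulhaber's formula itself telescopes: after binomial expansion, Φ(n+1) − Φ(n) = n^m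
-- reduces to the defining recurrence of the Bernoulli numbers.

module Submission where

open import Defs
open import Data.Nat as ℕ using (ℕ; zero; suc; _∸_; _⊓_; z≤n; s≤s; _≤_; _<_; _≤?_; _!)
import Data.Nat.Properties as ℕP
open import Data.Nat.Combinatorics
  using (_C_; nC1≡n; nCn≡1; nCk≡n!/k![n-k]!; k![n∸k]!∣n!; nCk+nC[k+1]≡[n+1]C[k+1]; k>n⇒nCk≡0; nCk≡nC[n∸k])
import Data.Nat.DivMod as ℕDM
open import Data.Nat.Tactic.RingSolver using (solve-∀)
import Data.Integer as ℤ
import Data.Integer.Properties as ℤP
open import Data.Rational using (ℚ; 0ℚ; 1ℚ; _+_; _*_; -_; mkℚ; Positive; toℚᵘ; 1/_)
open import Data.Rational.Properties hiding (_≤?_)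
import Data.Rational.Solver as ℚSolver
open import Algebra.Bundles using (CommutativeMonoid)
open import Algebra.Properties.CommutativeSemigroup
  (CommutativeMonoid.commutativeSemigroup +-0-commutativeMonoid) using (interchange)
import Data.Rational.Unnormalised as ℚᵘ
import Data.Rational.Unnormalised.Properties as ℚᵘP
import Data.Nat.Coprimality as Coprimality
open import Data.List using (List; []; _∷_; _++_; length)
open import Data.List.Properties using (length-++)
open import Data.Sum using (inj₁; inj₂)
open import Data.Product using (Σ; _×_; _,_)
open import Relation.Binary.PropositionalEquality
open import Relation.Nullary using (yes; no)
open ≡-Reasoning

m<o∸n⇒m+n<o : ∀ m n o → m < o ∸ n → m ℕ.+ n < o
m<o∸n⇒m+n<o m n o m<o∸n = ℕP.m≤o∸n⇒m+n≤o (suc m) n≤o m<o∸n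
  where
  n≤o : n ≤ o
  n≤o = ℕP.<⇒≤ (ℕP.m∸n≢0⇒n<m (λ o∸n≡0 → ℕP.n≮0 (subst (m <_) o∸n≡0 m<o∸n)))

nC[n∸1]≡n : ∀ n → suc n C n ≡ suc n
nC[n∸1]≡n n = trans (nCk≡nC[n∸k] (ℕP.n≤1+n n)) (trans (cong (suc n C_) (ℕP.m+n∸n≡m 1 n)) (nC1≡n (suc n)))

C*factorials : ∀ n k → k ≤ n → (n C k) ℕ.* (k ! ℕ.* (n ∸ k) !) ≡ n !
C*factorials n k k≤n = trans (cong (ℕ._* (k ! ℕ.* (n ∸ k) !)) (nCk≡n!/k![n-k]! k≤n))
  (ℕDM.m/n*n≡m {{ℕP._!*_!≢0 k (n ∸ k)}} (k![n∸k]!∣n! k≤n))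

trinomial : ∀ n j l → j ℕ.+ l ≤ n →
  (n C j) ℕ.* ((n ∸ j) C l) ℕ.* (j ! ℕ.* (l ! ℕ.* (n ∸ (j ℕ.+ l)) !)) ≡ n !
trinomial n j l j+l≤n = begin
  (n C j) ℕ.* ((n ∸ j) C l) ℕ.* (j ! ℕ.* (l ! ℕ.* (n ∸ (j ℕ.+ l)) !))
    ≡⟨ cong (λ m → (n C j) ℕ.* ((n ∸ j) C l) ℕ.* (j ! ℕ.* (l ! ℕ.* m !))) (sym (ℕP.∸-+-assoc n j l)) ⟩
  (n C j) ℕ.* ((n ∸ j) C l) ℕ.* (j ! ℕ.* (l ! ℕ.* (n ∸ j ∸ l) !))
    ≡⟨ regroup (n C j) ((n ∸ j) C l) (j !) (l ! ℕ.* (n ∸ j ∸ l) !) ⟩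
  (n C j) ℕ.* (j ! ℕ.* (((n ∸ j) C l) ℕ.* (l ! ℕ.* (n ∸ j ∸ l) !)))
    ≡⟨ cong (λ m → (n C j) ℕ.* (j ! ℕ.* m)) (C*factorials (n ∸ j) l (ℕP.m+n≤o⇒m≤o∸n l (subst (_≤ n) (ℕP.+-comm j l) j+l≤n))) ⟩
  (n C j) ℕ.* (j ! ℕ.* (n ∸ j) !)
    ≡⟨ C*factorials n j (ℕP.m+n≤o⇒m≤o j j+l≤n) ⟩
  n ! ∎
  where
  regroup : ∀ a b c e → a ℕ.* b ℕ.* (c ℕ.* e) ≡ a ℕ.* (c ℕ.* (b ℕ.* e))
  regroup = solve-∀

nCj*[n∸j]Cl≡nCl*[n∸l]Cj : ∀ n j l → j ℕ.+ l ≤ n → (n C j) ℕ.* ((n ∸ j) C l) ≡ (n C l) ℕ.* ((n ∸ l) C j)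
nCj*[n∸j]Cl≡nCl*[n∸l]Cj n j l j+l≤n =
  ℕP.*-cancelʳ-≡ _ _ (j ! ℕ.* (l ! ℕ.* (n ∸ (j ℕ.+ l)) !)) {{nonZero}} (begin
    (n C j) ℕ.* ((n ∸ j) C l) ℕ.* (j ! ℕ.* (l ! ℕ.* (n ∸ (j ℕ.+ l)) !))
      ≡⟨ trinomial n j l j+l≤n ⟩
    n !
      ≡⟨ sym (trinomial n l j (subst (_≤ n) (ℕP.+-comm j l) j+l≤n)) ⟩
    (n C l) ℕ.* ((n ∸ l) C j) ℕ.* (l ! ℕ.* (j ! ℕ.* (n ∸ (l ℕ.+ j)) !))
      ≡⟨ cong (λ m → (n C l) ℕ.* ((n ∸ l) C j) ℕ.* (l ! ℕ.* (j ! ℕ.* (n ∸ m) !))) (ℕP.+-comm l j) ⟩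
    (n C l) ℕ.* ((n ∸ l) C j) ℕ.* (l ! ℕ.* (j ! ℕ.* (n ∸ (j ℕ.+ l)) !))
      ≡⟨ cong ((n C l) ℕ.* ((n ∸ l) C j) ℕ.*_) (swap (l !) (j !) ((n ∸ (j ℕ.+ l)) !)) ⟩
    (n C l) ℕ.* ((n ∸ l) C j) ℕ.* (j ! ℕ.* (l ! ℕ.* (n ∸ (j ℕ.+ l)) !)) ∎)
  where
  nonZero : ℕ.NonZero (j ! ℕ.* (l ! ℕ.* (n ∸ (j ℕ.+ l)) !))
  nonZero = ℕP.m*n≢0 (j !) _ {{ℕP._!≢0 j}} {{ℕP._!*_!≢0 l (n ∸ (j ℕ.+ l))}}
  swap : ∀ a b c → a ℕ.* (b ℕ.* c) ≡ b ℕ.* (a ℕ.* c)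
  swap = solve-∀

coprime-1 : ∀ n → Coprimality.Coprime n 1
coprime-1 n = Coprimality.sym (Coprimality.1-coprimeTo n)

toℚ≡mkℚ : ∀ n → toℚ n ≡ mkℚ (ℤ.+ n) 0 (coprime-1 n)
toℚ≡mkℚ n = ↥p/↧p≡p _

toℚ-+ : ∀ a b → toℚ (a ℕ.+ b) ≡ toℚ a + toℚ b
toℚ-+ a b = toℚᵘ-injective (ℚᵘP.≃-trans (ℚᵘP.≃-reflexive (toℚᵘ-toℚ (a ℕ.+ b)))
  (ℚᵘP.≃-trans integer-sum (ℚᵘP.≃-sym (toℚᵘ-homo-+ (toℚ a) (toℚ b)))))
  where
  toℚᵘ-toℚ : ∀ n → toℚᵘ (toℚ n) ≡ ℚᵘ.mkℚᵘ (ℤ.+ n) 0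
  toℚᵘ-toℚ n = cong toℚᵘ (toℚ≡mkℚ n)
  integer-sum : ℚᵘ.mkℚᵘ (ℤ.+ (a ℕ.+ b)) 0 ℚᵘ.≃ toℚᵘ (toℚ a) ℚᵘ.+ toℚᵘ (toℚ b)
  integer-sum rewrite toℚᵘ-toℚ a | toℚᵘ-toℚ b =
    ℚᵘ.*≡* (cong₂ ℤ._*_ (cong₂ ℤ._+_ (sym (ℤP.*-identityʳ (ℤ.+ a))) (sym (ℤP.*-identityʳ (ℤ.+ b)))) refl)

toℚ-* : ∀ a b → toℚ (a ℕ.* b) ≡ toℚ a * toℚ b
toℚ-* zero    b = sym (*-zeroˡ (toℚ b))
toℚ-* (suc a) b = begin
  toℚ (b ℕ.+ a ℕ.* b)         ≡⟨ toℚ-+ b (a ℕ.* b) ⟩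
  toℚ b + toℚ (a ℕ.* b)       ≡⟨ cong₂ _+_ (sym (*-identityˡ (toℚ b))) (toℚ-* a b) ⟩
  1ℚ * toℚ b + toℚ a * toℚ b  ≡⟨ sym (*-distribʳ-+ (toℚ b) 1ℚ (toℚ a)) ⟩
  (1ℚ + toℚ a) * toℚ b        ≡⟨ cong (_* toℚ b) (sym (toℚ-+ 1 a)) ⟩
  toℚ (suc a) * toℚ b         ∎

toℚ-^ : ∀ a e → toℚ (a ℕ.^ e) ≡ toℚ a ^ℚ e
toℚ-^ a zero    = refl
toℚ-^ a (suc e) = trans (toℚ-* a (a ℕ.^ e)) (cong (toℚ a *_) (toℚ-^ a e))

inv≡1/mkℚ : ∀ n → inv (suc n) ≡ 1/ mkℚ (ℤ.+ suc n) 0 (coprime-1 (suc n))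
inv≡1/mkℚ n = ↥p/↧p≡p _

toℚ*inv : ∀ n → toℚ (suc n) * inv (suc n) ≡ 1ℚ
toℚ*inv n rewrite toℚ≡mkℚ (suc n) | inv≡1/mkℚ n = *-inverseʳ (mkℚ (ℤ.+ suc n) 0 (coprime-1 (suc n)))

inv-pos : ∀ n → Positive (inv (suc n))
inv-pos n = normalize-pos 1 (suc n)

^ℚ-+ : ∀ x a b → x ^ℚ (a ℕ.+ b) ≡ x ^ℚ a * x ^ℚ b
^ℚ-+ x zero    b = sym (*-identityˡ _)
^ℚ-+ x (suc a) b = trans (cong (x *_) (^ℚ-+ x a b)) (sym (*-assoc x _ _))

σ-cong-< : ∀ {f g : ℕ → ℚ} n → (∀ k → k < n → f k ≡ g k) → σ f n ≡ σ g n
σ-cong-< zero    f≡g = refl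
σ-cong-< (suc n) f≡g = cong₂ _+_ (σ-cong-< n (λ k k<n → f≡g k (ℕP.m<n⇒m<1+n k<n))) (f≡g n ℕP.≤-refl)

σ-cong : ∀ {f g : ℕ → ℚ} n → (∀ k → f k ≡ g k) → σ f n ≡ σ g n
σ-cong n f≡g = σ-cong-< n (λ k _ → f≡g k)

σ-zero : ∀ n → σ (λ _ → 0ℚ) n ≡ 0ℚ
σ-zero zero    = refl
σ-zero (suc n) = trans (+-identityʳ _) (σ-zero n)

σ-+ : ∀ (f g : ℕ → ℚ) n → σ (λ k → f k + g k) n ≡ σ f n + σ g n
σ-+ f g zero    = refl
σ-+ f g (suc n) = trans (cong (_+ (f n + g n)) (σ-+ f g n)) (interchange (σ f n) (σ g n) (f n) (g n))

σ-*ˡ : ∀ a (f : ℕ → ℚ) n → σ (λ k → a * f k) n ≡ a * σ f n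
σ-*ˡ a f zero    = sym (*-zeroʳ a)
σ-*ˡ a f (suc n) = trans (cong (_+ a * f n) (σ-*ˡ a f n)) (sym (*-distribˡ-+ a _ _))

σ-*ʳ : ∀ a (f : ℕ → ℚ) n → σ (λ k → f k * a) n ≡ σ f n * a
σ-*ʳ a f n = trans (σ-cong n (λ k → *-comm (f k) a)) (trans (σ-*ˡ a f n) (*-comm a _))

σ-head : ∀ (f : ℕ → ℚ) n → σ f (suc n) ≡ f 0 + σ (λ k → f (suc k)) n
σ-head f zero    = trans (+-identityˡ (f 0)) (sym (+-identityʳ (f 0)))
σ-head f (suc n) = trans (cong (_+ f (suc n)) (σ-head f n)) (+-assoc (f 0) _ (f (suc n)))

σ-comm : ∀ (f : ℕ → ℕ → ℚ) m n → σ (λ i → σ (f i) m) n ≡ σ (λ j → σ (λ i → f i j) n) m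
σ-comm f m zero    = sym (σ-zero m)
σ-comm f m (suc n) = trans (cong (_+ σ (f n) m) (σ-comm f m n)) (sym (σ-+ (λ j → σ (λ i → f i j) n) (f n) m))

σ-reverse : ∀ (f : ℕ → ℚ) n → σ f n ≡ σ (λ k → f (n ∸ suc k)) n
σ-reverse f zero    = refl
σ-reverse f (suc n) = begin
  σ f n + f n                       ≡⟨ +-comm (σ f n) (f n) ⟩
  f n + σ f n                       ≡⟨ cong (f n +_) (σ-reverse f n) ⟩
  f n + σ (λ k → f (n ∸ suc k)) n   ≡⟨ sym (σ-head (λ k → f (suc n ∸ suc k)) n) ⟩
  σ (λ k → f (suc n ∸ suc k)) (suc n) ∎

module _ (g : ℕ → ℕ → ℚ) (D : ℕ) where
  private
    L′ L E : ℕ → ℚ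
    L′ a = σ (g a) (suc D ∸ a)
    L  a = σ (g a) (D ∸ a)
    E  a = g a (D ∸ a)

  σ-inner-suc : ∀ N → σ L′ N ≡ σ L N + σ E (N ⊓ suc D)
  σ-inner-suc zero = sym (+-identityʳ 0ℚ)
  σ-inner-suc (suc N) with N ≤? D
  ... | yes N≤D = begin
    σ L′ N + σ (g N) (suc D ∸ N)
      ≡⟨ cong₂ _+_ (σ-inner-suc N) (cong (σ (g N)) (ℕP.+-∸-assoc 1 N≤D)) ⟩
    (σ L N + σ E (N ⊓ suc D)) + (σ (g N) (D ∸ N) + E N)
      ≡⟨ interchange (σ L N) _ _ (E N) ⟩
    σ L (suc N) + (σ E (N ⊓ suc D) + E N)
      ≡⟨ cong (λ m → σ L (suc N) + (σ E m + E N)) (ℕP.m≤n⇒m⊓n≡m (ℕP.m≤n⇒m≤1+n N≤D)) ⟩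
    σ L (suc N) + σ E (suc N)
      ≡⟨ cong (λ m → σ L (suc N) + σ E (suc m)) (sym (ℕP.m≤n⇒m⊓n≡m N≤D)) ⟩
    σ L (suc N) + σ E (suc N ⊓ suc D) ∎
  ... | no N≰D = begin
    σ L′ N + σ (g N) (suc D ∸ N)
      ≡⟨ cong₂ _+_ (σ-inner-suc N) (cong (σ (g N)) (ℕP.m≤n⇒m∸n≡0 D<N)) ⟩
    (σ L N + σ E (N ⊓ suc D)) + 0ℚ
      ≡⟨ +-identityʳ _ ⟩
    σ L N + σ E (N ⊓ suc D)
      ≡⟨ cong₂ _+_ (sym (+-identityʳ (σ L N))) (cong (σ E) (ℕP.m≥n⇒m⊓n≡n D<N)) ⟩
    (σ L N + 0ℚ) + σ E (suc D)
      ≡⟨ cong₂ (λ m k → (σ L N + σ (g N) m) + σ E (suc k))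
           (sym (ℕP.m≤n⇒m∸n≡0 (ℕP.<⇒≤ D<N))) (sym (ℕP.m≥n⇒m⊓n≡n (ℕP.<⇒≤ D<N))) ⟩
    σ L (suc N) + σ E (suc N ⊓ suc D) ∎
    where D<N = ℕP.≰⇒> N≰D

σ-triangle : ∀ (f : ℕ → ℕ → ℚ) M D →
  σ (λ i → σ (λ a → f a i) (suc (i ⊓ M))) D ≡ σ (λ a → σ (λ j → f a (a ℕ.+ j)) (D ∸ a)) (suc M)
σ-triangle f M zero = sym (trans (σ-cong (suc M) (λ a → cong (σ _) (ℕP.0∸n≡0 a))) (σ-zero (suc M)))
σ-triangle f M (suc D) = begin
  σ (λ i → σ (λ a → f a i) (suc (i ⊓ M))) D + σ (λ a → f a D) (suc (D ⊓ M))
    ≡⟨ cong₂ _+_ (σ-triangle f M D) (cong (λ m → σ (λ a → f a D) (suc m)) (ℕP.⊓-comm D M)) ⟩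
  σ (λ a → σ (g a) (D ∸ a)) (suc M) + σ (λ a → f a D) (suc (M ⊓ D))
    ≡⟨ cong (σ (λ a → σ (g a) (D ∸ a)) (suc M) +_) (σ-cong-< (suc (M ⊓ D)) on-antidiagonal) ⟩
  σ (λ a → σ (g a) (D ∸ a)) (suc M) + σ (λ a → g a (D ∸ a)) (suc (M ⊓ D))
    ≡⟨ sym (σ-inner-suc g D (suc M)) ⟩
  σ (λ a → σ (g a) (suc D ∸ a)) (suc M) ∎
  where
  g : ℕ → ℕ → ℚ
  g a j = f a (a ℕ.+ j)
  on-antidiagonal : ∀ a → a < suc (M ⊓ D) → f a D ≡ g a (D ∸ a)
  on-antidiagonal a (s≤s a≤M⊓D) = cong (f a) (sym (ℕP.m+[n∸m]≡n (ℕP.≤-trans a≤M⊓D (ℕP.m⊓n≤n M D))))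

σ-antidiagonal-swap : ∀ (g : ℕ → ℕ → ℚ) D →
  σ (λ j → σ (g j) (D ∸ j)) D ≡ σ (λ l → σ (λ j → g j l) (D ∸ l)) D
σ-antidiagonal-swap g zero    = refl
σ-antidiagonal-swap g (suc D) = begin
  σ (λ j → σ (g j) (suc D ∸ j)) (suc D)
    ≡⟨ extend g ⟩
  σ (λ j → σ (g j) (D ∸ j)) D + σ (λ j → g j (D ∸ j)) (suc D)
    ≡⟨ cong₂ _+_ (σ-antidiagonal-swap g D) (trans (σ-reverse _ (suc D)) (σ-cong-< (suc D) reflect)) ⟩
  σ (λ l → σ (λ j → g j l) (D ∸ l)) D + σ (λ l → g (D ∸ l) l) (suc D)
    ≡⟨ sym (extend (λ l j → g j l)) ⟩
  σ (λ l → σ (λ j → g j l) (suc D ∸ l)) (suc D) ∎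
  where
  extend : ∀ (h : ℕ → ℕ → ℚ) →
    σ (λ j → σ (h j) (suc D ∸ j)) (suc D) ≡ σ (λ j → σ (h j) (D ∸ j)) D + σ (λ j → h j (D ∸ j)) (suc D)
  extend h = begin
    σ (λ j → σ (h j) (suc D ∸ j)) (suc D)
      ≡⟨ σ-inner-suc h D (suc D) ⟩
    (σ (λ j → σ (h j) (D ∸ j)) D + σ (h D) (D ∸ D)) + σ (λ j → h j (D ∸ j)) (suc (D ⊓ D))
      ≡⟨ cong₂ (λ m k → (σ (λ j → σ (h j) (D ∸ j)) D + σ (h D) m) + σ (λ j → h j (D ∸ j)) (suc k))
           (ℕP.n∸n≡0 D) (ℕP.⊓-idem D) ⟩
    (σ (λ j → σ (h j) (D ∸ j)) D + 0ℚ) + σ (λ j → h j (D ∸ j)) (suc D)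
      ≡⟨ cong (_+ σ (λ j → h j (D ∸ j)) (suc D)) (+-identityʳ (σ (λ j → σ (h j) (D ∸ j)) D)) ⟩
    σ (λ j → σ (h j) (D ∸ j)) D + σ (λ j → h j (D ∸ j)) (suc D) ∎
  reflect : ∀ l → l < suc D → g (D ∸ l) (D ∸ (D ∸ l)) ≡ g (D ∸ l) l
  reflect l (s≤s l≤D) = cong (g (D ∸ l)) (ℕP.m∸[m∸n]≡n l≤D)

σℕ-cong-< : ∀ {f g : ℕ → ℕ} n → (∀ k → k < n → f k ≡ g k) → σℕ f n ≡ σℕ g n
σℕ-cong-< zero    f≡g = refl
σℕ-cong-< (suc n) f≡g = cong₂ ℕ._+_ (σℕ-cong-< n (λ k k<n → f≡g k (ℕP.m<n⇒m<1+n k<n))) (f≡g n ℕP.≤-refl)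

σℕ-+ : ∀ (f g : ℕ → ℕ) n → σℕ (λ k → f k ℕ.+ g k) n ≡ σℕ f n ℕ.+ σℕ g n
σℕ-+ f g zero    = refl
σℕ-+ f g (suc n) = trans (cong (ℕ._+ (f n ℕ.+ g n)) (σℕ-+ f g n)) (interchange′ (σℕ f n) (σℕ g n) (f n) (g n))
  where
  interchange′ : ∀ a b c e → a ℕ.+ b ℕ.+ (c ℕ.+ e) ≡ a ℕ.+ c ℕ.+ (b ℕ.+ e)
  interchange′ = solve-∀

σℕ-*ʳ : ∀ a (f : ℕ → ℕ) n → σℕ (λ k → f k ℕ.* a) n ≡ σℕ f n ℕ.* a
σℕ-*ʳ a f zero    = refl
σℕ-*ʳ a f (suc n) = trans (cong (ℕ._+ f n ℕ.* a) (σℕ-*ʳ a f n)) (sym (ℕP.*-distribʳ-+ a (σℕ f n) (f n)))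

toℚ-σℕ : ∀ (f : ℕ → ℕ) n → toℚ (σℕ f n) ≡ σ (λ k → toℚ (f k)) n
toℚ-σℕ f zero    = refl
toℚ-σℕ f (suc n) = trans (toℚ-+ (σℕ f n) (f n)) (cong (_+ toℚ (f n)) (toℚ-σℕ f n))

-- Bernoulli numbers and Faulhaber's formula

binomial : ∀ x e → (1ℚ + x) ^ℚ e ≡ σ (λ l → toℚ (e C l) * x ^ℚ l) (suc e)
binomial x zero    = refl
binomial x (suc e) = begin
  (1ℚ + x) * (1ℚ + x) ^ℚ e                      ≡⟨ cong ((1ℚ + x) *_) (binomial x e) ⟩
  (1ℚ + x) * σ f (suc e)                         ≡⟨ *-distribʳ-+ (σ f (suc e)) 1ℚ x ⟩
  1ℚ * σ f (suc e) + x * σ f (suc e)             ≡⟨ cong₂ _+_ (*-identityˡ (σ f (suc e))) (sym (σ-*ˡ x f (suc e))) ⟩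
  σ f (suc e) + σ (λ l → x * f l) (suc e)        ≡⟨ cong₂ _+_ shift (σ-cong (suc e) times-x) ⟩
  (1ℚ + σ f₊ (suc e)) + σ g (suc e)              ≡⟨ +-assoc 1ℚ (σ f₊ (suc e)) (σ g (suc e)) ⟩
  1ℚ + (σ f₊ (suc e) + σ g (suc e))              ≡⟨ cong (1ℚ +_) (sym (σ-+ f₊ g (suc e))) ⟩
  1ℚ + σ (λ l → f₊ l + g l) (suc e)              ≡⟨ cong (1ℚ +_) (σ-cong (suc e) pascal) ⟩
  1ℚ + σ (λ l → toℚ (suc e C suc l) * x ^ℚ suc l) (suc e)
    ≡⟨ sym (σ-head (λ l → toℚ (suc e C l) * x ^ℚ l) (suc e)) ⟩
  σ (λ l → toℚ (suc e C l) * x ^ℚ l) (suc (suc e)) ∎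
  where
  f f₊ g : ℕ → ℚ
  f  l = toℚ (e C l) * x ^ℚ l
  f₊ l = toℚ (e C suc l) * x ^ℚ suc l
  g  l = toℚ (e C l) * x ^ℚ suc l
  shift : σ f (suc e) ≡ 1ℚ + σ f₊ (suc e)
  shift = begin
    σ f (suc e)                           ≡⟨ σ-head f e ⟩
    1ℚ + σ f₊ e                           ≡⟨ cong (1ℚ +_) (sym (+-identityʳ (σ f₊ e))) ⟩
    1ℚ + (σ f₊ e + 0ℚ)                    ≡⟨ cong (λ z → 1ℚ + (σ f₊ e + z)) (sym top-vanishes) ⟩
    1ℚ + σ f₊ (suc e)                     ∎
    where
    top-vanishes : f₊ e ≡ 0ℚ
    top-vanishes = trans (cong (λ c → toℚ c * x ^ℚ suc e) (k>n⇒nCk≡0 (ℕP.n<1+n e))) (*-zeroˡ (x ^ℚ suc e))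
  times-x : ∀ l → x * f l ≡ g l
  times-x l = trans (sym (*-assoc x c (x ^ℚ l))) (trans (cong (_* x ^ℚ l) (*-comm x c)) (*-assoc c x (x ^ℚ l)))
    where c = toℚ (e C l)
  pascal : ∀ l → f₊ l + g l ≡ toℚ (suc e C suc l) * x ^ℚ suc l
  pascal l = begin
    toℚ (e C suc l) * x ^ℚ suc l + toℚ (e C l) * x ^ℚ suc l ≡⟨ sym (*-distribʳ-+ (x ^ℚ suc l) (toℚ (e C suc l)) (toℚ (e C l))) ⟩
    (toℚ (e C suc l) + toℚ (e C l)) * x ^ℚ suc l           ≡⟨ cong (_* x ^ℚ suc l) (sym (toℚ-+ (e C suc l) (e C l))) ⟩
    toℚ (e C suc l ℕ.+ e C l) * x ^ℚ suc l                  ≡⟨ cong (λ c → toℚ c * x ^ℚ suc l) (ℕP.+-comm (e C suc l) (e C l)) ⟩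
    toℚ (e C l ℕ.+ e C suc l) * x ^ℚ suc l                  ≡⟨ cong (λ c → toℚ c * x ^ℚ suc l) (nCk+nC[k+1]≡[n+1]C[k+1] e l) ⟩
    toℚ (suc e C suc l) * x ^ℚ suc l                         ∎

binomial-lower : ∀ x e → (1ℚ + x) ^ℚ e ≡ x ^ℚ e + σ (λ l → toℚ (e C l) * x ^ℚ l) e
binomial-lower x e = begin
  (1ℚ + x) ^ℚ e                                   ≡⟨ binomial x e ⟩
  σ (λ l → toℚ (e C l) * x ^ℚ l) e + toℚ (e C e) * x ^ℚ e
    ≡⟨ cong (λ c → σ (λ l → toℚ (e C l) * x ^ℚ l) e + toℚ c * x ^ℚ e) (nCn≡1 e) ⟩
  σ (λ l → toℚ (e C l) * x ^ℚ l) e + 1ℚ * x ^ℚ e  ≡⟨ cong (σ (λ l → toℚ (e C l) * x ^ℚ l) e +_) (*-identityˡ (x ^ℚ e)) ⟩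
  σ (λ l → toℚ (e C l) * x ^ℚ l) e + x ^ℚ e       ≡⟨ +-comm (σ (λ l → toℚ (e C l) * x ^ℚ l) e) (x ^ℚ e) ⟩
  x ^ℚ e + σ (λ l → toℚ (e C l) * x ^ℚ l) e       ∎

nth-++ : ∀ (xs ys : List ℚ) j → j < length xs → nth (xs ++ ys) j ≡ nth xs j
nth-++ (x ∷ xs) ys zero    _         = refl
nth-++ (x ∷ xs) ys (suc j) (s≤s j<n) = nth-++ xs ys j j<n

nth-length : ∀ (xs : List ℚ) y → nth (xs ++ y ∷ []) (length xs) ≡ y
nth-length []       y = refl
nth-length (x ∷ xs) y = nth-length xs y

length-Bs : ∀ n → length (Bs n) ≡ n
length-Bs zero    = refl
length-Bs (suc n) = trans (length-++ (Bs n)) (trans (ℕP.+-comm _ 1) (cong suc (length-Bs n)))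

nth-Bs : ∀ n j → j < n → nth (Bs n) j ≡ B j
nth-Bs (suc n) j (s≤s j≤n) with ℕP.m≤n⇒m<n∨m≡n j≤n
... | inj₁ j<n  = trans (nth-++ (Bs n) _ j (subst (j <_) (sym (length-Bs n)) j<n)) (nth-Bs n j j<n)
... | inj₂ refl = refl

nextB-suc : ∀ bs k → length bs ≡ suc k →
  nextB bs ≡ - (inv (suc (suc k)) * σ (λ j → toℚ (suc (suc k) C j) * nth bs j) (suc k))
nextB-suc bs k eq with length bs
nextB-suc bs k refl | .(suc k) = refl

B-suc : ∀ M → B (suc M) ≡ - (inv (suc (suc M)) * σ (λ j → toℚ (suc (suc M) C j) * B j) (suc M))
B-suc M = begin
  nth (Bs (suc M) ++ nextB (Bs (suc M)) ∷ []) (suc M)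
    ≡⟨ cong (nth (Bs (suc M) ++ nextB (Bs (suc M)) ∷ [])) (sym (length-Bs (suc M))) ⟩
  nth (Bs (suc M) ++ nextB (Bs (suc M)) ∷ []) (length (Bs (suc M)))
    ≡⟨ nth-length (Bs (suc M)) _ ⟩
  nextB (Bs (suc M))
    ≡⟨ nextB-suc (Bs (suc M)) M (length-Bs (suc M)) ⟩
  - (inv (suc (suc M)) * σ (λ j → toℚ (suc (suc M) C j) * nth (Bs (suc M)) j) (suc M))
    ≡⟨ cong (λ s → - (inv (suc (suc M)) * s))
         (σ-cong-< (suc M) (λ j j<M → cong (toℚ (suc (suc M) C j) *_) (nth-Bs (suc M) j j<M))) ⟩
  - (inv (suc (suc M)) * σ (λ j → toℚ (suc (suc M) C j) * B j) (suc M)) ∎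

bernoulliSum : ℕ → ℚ
bernoulliSum E = σ (λ j → toℚ (E C j) * B j) E

bernoulliSum[2+M]≡0 : ∀ M → bernoulliSum (suc (suc M)) ≡ 0ℚ
bernoulliSum[2+M]≡0 M = begin
  X + toℚ (suc (suc M) C suc M) * B (suc M)
    ≡⟨ cong₂ (λ c b → X + toℚ c * b) (nC[n∸1]≡n (suc M)) (B-suc M) ⟩
  X + N * - (inv (suc (suc M)) * X)   ≡⟨ cong (X +_) (sym (neg-distribʳ-* N _)) ⟩
  X + - (N * (inv (suc (suc M)) * X)) ≡⟨ cong (λ z → X + - z) (sym (*-assoc N _ X)) ⟩
  X + - (N * inv (suc (suc M)) * X)   ≡⟨ cong (λ z → X + - (z * X)) (toℚ*inv (suc M)) ⟩
  X + - (1ℚ * X)                      ≡⟨ cong (λ z → X + - z) (*-identityˡ X) ⟩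
  X + - X                             ≡⟨ +-inverseʳ X ⟩
  0ℚ                                  ∎
  where
  X = σ (λ j → toℚ (suc (suc M) C j) * B j) (suc M)
  N = toℚ (suc (suc M))

σ-*bernoulliSum : ∀ (K : ℕ → ℚ) m → σ (λ l → K l * bernoulliSum (suc m ∸ l)) (suc m) ≡ K m
σ-*bernoulliSum K m = begin
  σ (λ l → K l * bernoulliSum (suc m ∸ l)) m + K m * bernoulliSum (suc m ∸ m)
    ≡⟨ cong₂ _+_ (trans (σ-cong-< m lower-terms-vanish) (σ-zero m)) top-term ⟩
  0ℚ + K m
    ≡⟨ +-identityˡ (K m) ⟩
  K m ∎
  where
  lower-terms-vanish : ∀ l → l < m → K l * bernoulliSum (suc m ∸ l) ≡ 0ℚ
  lower-terms-vanish l l<m = begin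
    K l * bernoulliSum (suc m ∸ l)              ≡⟨ cong (λ e → K l * bernoulliSum e) (ℕP.+-∸-assoc 1 (ℕP.<⇒≤ l<m)) ⟩
    K l * bernoulliSum (suc (m ∸ l))            ≡⟨ cong (λ e → K l * bernoulliSum (suc e)) (ℕP.+-∸-assoc 1 l<m) ⟩
    K l * bernoulliSum (suc (suc (m ∸ suc l)))  ≡⟨ cong (K l *_) (bernoulliSum[2+M]≡0 (m ∸ suc l)) ⟩
    K l * 0ℚ                                    ≡⟨ *-zeroʳ (K l) ⟩
    0ℚ                                          ∎
  top-term : K m * bernoulliSum (suc m ∸ m) ≡ K m
  top-term = trans (cong (λ e → K m * bernoulliSum e) (ℕP.m+n∸n≡m 1 m)) (*-identityʳ (K m))

-- term p k a b unfolds to faulhaberCoeff (d p k ∸ a) (b ∸ a).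
faulhaberCoeff : ℕ → ℕ → ℚ
faulhaberCoeff E j = toℚ (E C j) * B j * inv E

faulhaber : ℕ → ℚ → ℚ
faulhaber E x = σ (λ j → faulhaberCoeff E j * x ^ℚ (E ∸ j)) E

faulhaberCoeff*binomial : ∀ D j l y → j ℕ.+ l ≤ D →
  faulhaberCoeff D j * (toℚ ((D ∸ j) C l) * y) ≡ toℚ (D C l) * inv D * y * (toℚ ((D ∸ l) C j) * B j)
faulhaberCoeff*binomial D j l y j+l≤D = begin
  toℚ (D C j) * B j * inv D * (toℚ ((D ∸ j) C l) * y)
    ≡⟨ regroup (toℚ (D C j)) (toℚ ((D ∸ j) C l)) (B j) (inv D) y ⟩
  toℚ (D C j) * toℚ ((D ∸ j) C l) * (B j * inv D * y)
    ≡⟨ cong (_* (B j * inv D * y)) product-of-binomials ⟩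
  toℚ (D C l) * toℚ ((D ∸ l) C j) * (B j * inv D * y)
    ≡⟨ regroup′ (toℚ (D C l)) (toℚ ((D ∸ l) C j)) (B j) (inv D) y ⟩
  toℚ (D C l) * inv D * y * (toℚ ((D ∸ l) C j) * B j) ∎
  where
  open ℚSolver.+-*-Solver
  regroup : ∀ a b β ι y → a * β * ι * (b * y) ≡ a * b * (β * ι * y)
  regroup = solve 5 (λ a b β ι y → a :* β :* ι :* (b :* y) := a :* b :* (β :* ι :* y)) refl
  regroup′ : ∀ a b β ι y → a * b * (β * ι * y) ≡ a * ι * y * (b * β)
  regroup′ = solve 5 (λ a b β ι y → a :* b :* (β :* ι :* y) := a :* ι :* y :* (b :* β)) refl
  product-of-binomials : toℚ (D C j) * toℚ ((D ∸ j) C l) ≡ toℚ (D C l) * toℚ ((D ∸ l) C j)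
  product-of-binomials = begin
    toℚ (D C j) * toℚ ((D ∸ j) C l)   ≡⟨ sym (toℚ-* (D C j) ((D ∸ j) C l)) ⟩
    toℚ ((D C j) ℕ.* ((D ∸ j) C l))   ≡⟨ cong toℚ (nCj*[n∸j]Cl≡nCl*[n∸l]Cj D j l j+l≤D) ⟩
    toℚ ((D C l) ℕ.* ((D ∸ l) C j))   ≡⟨ toℚ-* (D C l) ((D ∸ l) C j) ⟩
    toℚ (D C l) * toℚ ((D ∸ l) C j)   ∎

-- After the swap, the coefficient of x^l is a multiple of bernoulliSum (m + 1 − l), which vanishes unless l = m.
faulhaber-increment : ∀ m x →
  σ (λ j → faulhaberCoeff (suc m) j * σ (λ l → toℚ ((suc m ∸ j) C l) * x ^ℚ l) (suc m ∸ j)) (suc m) ≡ x ^ℚ m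
faulhaber-increment m x = begin
  σ (λ j → faulhaberCoeff D j * σ (binomialTerm j) (D ∸ j)) D
    ≡⟨ σ-cong D (λ j → sym (σ-*ˡ (faulhaberCoeff D j) _ (D ∸ j))) ⟩
  σ (λ j → σ (λ l → faulhaberCoeff D j * binomialTerm j l) (D ∸ j)) D
    ≡⟨ σ-antidiagonal-swap (λ j l → faulhaberCoeff D j * binomialTerm j l) D ⟩
  σ (λ l → σ (λ j → faulhaberCoeff D j * binomialTerm j l) (D ∸ l)) D
    ≡⟨ σ-cong D (λ l → σ-cong-< (D ∸ l) (λ j j<D∸l →
         faulhaberCoeff*binomial D j l (x ^ℚ l) (ℕP.<⇒≤ (m<o∸n⇒m+n<o j l D j<D∸l)))) ⟩
  σ (λ l → σ (λ j → K l * (toℚ ((D ∸ l) C j) * B j)) (D ∸ l)) D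
    ≡⟨ σ-cong D (λ l → σ-*ˡ (K l) _ (D ∸ l)) ⟩
  σ (λ l → K l * bernoulliSum (D ∸ l)) D
    ≡⟨ σ-*bernoulliSum K m ⟩
  toℚ (D C m) * inv D * x ^ℚ m
    ≡⟨ cong (λ e → toℚ e * inv D * x ^ℚ m) (nC[n∸1]≡n m) ⟩
  toℚ D * inv D * x ^ℚ m
    ≡⟨ cong (_* x ^ℚ m) (toℚ*inv m) ⟩
  1ℚ * x ^ℚ m
    ≡⟨ *-identityˡ (x ^ℚ m) ⟩
  x ^ℚ m ∎
  where
  D = suc m
  binomialTerm : ℕ → ℕ → ℚ
  binomialTerm j l = toℚ ((D ∸ j) C l) * x ^ℚ l
  K : ℕ → ℚ
  K l = toℚ (D C l) * inv D * x ^ℚ l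

faulhaber-step : ∀ m x → faulhaber (suc m) (1ℚ + x) ≡ faulhaber (suc m) x + x ^ℚ m
faulhaber-step m x = begin
  faulhaber D (1ℚ + x)
    ≡⟨ σ-cong D (λ j → trans (cong (c j *_) (binomial-lower x (D ∸ j))) (*-distribˡ-+ (c j) _ _)) ⟩
  σ (λ j → c j * x ^ℚ (D ∸ j) + c j * σ (λ l → toℚ ((D ∸ j) C l) * x ^ℚ l) (D ∸ j)) D
    ≡⟨ σ-+ _ _ D ⟩
  faulhaber D x + σ (λ j → c j * σ (λ l → toℚ ((D ∸ j) C l) * x ^ℚ l) (D ∸ j)) D
    ≡⟨ cong (faulhaber D x +_) (faulhaber-increment m x) ⟩
  faulhaber D x + x ^ℚ m ∎
  where
  D = suc m
  c : ℕ → ℚ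
  c = faulhaberCoeff D

sum-of-powers : ∀ m n → σ (λ k → toℚ k ^ℚ m) n ≡ faulhaber (suc m) (toℚ n)
sum-of-powers m zero    = sym (trans (σ-cong-< (suc m) vanishes-at-0) (σ-zero (suc m)))
  where
  vanishes-at-0 : ∀ j → j < suc m → faulhaberCoeff (suc m) j * 0ℚ ^ℚ (suc m ∸ j) ≡ 0ℚ
  vanishes-at-0 j (s≤s j≤m) = begin
    faulhaberCoeff (suc m) j * 0ℚ ^ℚ (suc m ∸ j)   ≡⟨ cong (λ e → faulhaberCoeff (suc m) j * 0ℚ ^ℚ e) (ℕP.+-∸-assoc 1 j≤m) ⟩
    faulhaberCoeff (suc m) j * (0ℚ * 0ℚ ^ℚ (m ∸ j)) ≡⟨ cong (faulhaberCoeff (suc m) j *_) (*-zeroˡ (0ℚ ^ℚ (m ∸ j))) ⟩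
    faulhaberCoeff (suc m) j * 0ℚ                   ≡⟨ *-zeroʳ (faulhaberCoeff (suc m) j) ⟩
    0ℚ                                              ∎
sum-of-powers m (suc n) = begin
  σ (λ k → toℚ k ^ℚ m) n + toℚ n ^ℚ m          ≡⟨ cong (_+ toℚ n ^ℚ m) (sum-of-powers m n) ⟩
  faulhaber (suc m) (toℚ n) + toℚ n ^ℚ m       ≡⟨ sym (faulhaber-step m (toℚ n)) ⟩
  faulhaber (suc m) (1ℚ + toℚ n)               ≡⟨ cong (faulhaber (suc m)) (sym (toℚ-+ 1 n)) ⟩
  faulhaber (suc m) (toℚ (suc n))              ∎

-- The recursion for F

Fgen-empty : ∀ p i r n → Fgen p i (suc r) n n ≡ 0
Fgen-empty p i r n = cong (σℕ _) (ℕP.n∸n≡0 n)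

Fgen-split-top : ∀ p i r m n → m ≤ n →
  Fgen p i (suc r) m (suc n)
    ≡ σℕ (λ j → (m ℕ.+ j) ℕ.^ p i ℕ.* Fgen p (suc i) r (suc (m ℕ.+ j)) (suc n)) (n ∸ m)
      ℕ.+ n ℕ.^ p i ℕ.* Fgen p (suc i) r (suc n) (suc n)
Fgen-split-top p i r m n m≤n = begin
  σℕ h (suc n ∸ m)             ≡⟨ cong (σℕ h) (ℕP.+-∸-assoc 1 m≤n) ⟩
  σℕ h (n ∸ m) ℕ.+ h (n ∸ m)   ≡⟨ cong (λ k → σℕ h (n ∸ m) ℕ.+ k ℕ.^ p i ℕ.* Fgen p (suc i) r (suc k) (suc n)) (ℕP.m+[n∸m]≡n m≤n) ⟩
  σℕ h (n ∸ m) ℕ.+ n ℕ.^ p i ℕ.* Fgen p (suc i) r (suc n) (suc n) ∎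
  where
  h : ℕ → ℕ
  h j = (m ℕ.+ j) ℕ.^ p i ℕ.* Fgen p (suc i) r (suc (m ℕ.+ j)) (suc n)

-- The new tuples are those whose largest index is n.
Fgen-last : ∀ p i r m n → m ≤ n →
  Fgen p i (suc r) m (suc n) ≡ Fgen p i (suc r) m n ℕ.+ Fgen p i r m n ℕ.* n ℕ.^ p (i ℕ.+ r)
Fgen-last p i zero m n m≤n = begin
  Fgen p i 1 m (suc n)                     ≡⟨ Fgen-split-top p i 0 m n m≤n ⟩
  Fgen p i 1 m n ℕ.+ n ℕ.^ p i ℕ.* 1       ≡⟨ cong (Fgen p i 1 m n ℕ.+_) (ℕP.*-comm (n ℕ.^ p i) 1) ⟩
  Fgen p i 1 m n ℕ.+ 1 ℕ.* n ℕ.^ p i       ≡⟨ cong (λ k → Fgen p i 1 m n ℕ.+ 1 ℕ.* n ℕ.^ p k) (sym (ℕP.+-identityʳ i)) ⟩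
  Fgen p i 1 m n ℕ.+ 1 ℕ.* n ℕ.^ p (i ℕ.+ 0) ∎
Fgen-last p i (suc r) m n m≤n = begin
  Fgen p i (suc (suc r)) m (suc n)
    ≡⟨ Fgen-split-top p i (suc r) m n m≤n ⟩
  σℕ (λ j → a j ℕ.* Fgen p (suc i) (suc r) (suc (m ℕ.+ j)) (suc n)) (n ∸ m)
    ℕ.+ n ℕ.^ p i ℕ.* Fgen p (suc i) (suc r) (suc n) (suc n)
    ≡⟨ cong₂ ℕ._+_ (σℕ-cong-< (n ∸ m) split-inner) (cong (n ℕ.^ p i ℕ.*_) (Fgen-empty p (suc i) r (suc n))) ⟩
  σℕ (λ j → T₁ j ℕ.+ T₀ j ℕ.* N) (n ∸ m) ℕ.+ n ℕ.^ p i ℕ.* 0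
    ≡⟨ trans (cong (σℕ (λ j → T₁ j ℕ.+ T₀ j ℕ.* N) (n ∸ m) ℕ.+_) (ℕP.*-zeroʳ (n ℕ.^ p i))) (ℕP.+-identityʳ _) ⟩
  σℕ (λ j → T₁ j ℕ.+ T₀ j ℕ.* N) (n ∸ m)
    ≡⟨ trans (σℕ-+ T₁ _ (n ∸ m)) (cong (σℕ T₁ (n ∸ m) ℕ.+_) (σℕ-*ʳ N T₀ (n ∸ m))) ⟩
  Fgen p i (suc (suc r)) m n ℕ.+ Fgen p i (suc r) m n ℕ.* N
    ≡⟨ cong (λ k → Fgen p i (suc (suc r)) m n ℕ.+ Fgen p i (suc r) m n ℕ.* n ℕ.^ p k) (sym (ℕP.+-suc i r)) ⟩
  Fgen p i (suc (suc r)) m n ℕ.+ Fgen p i (suc r) m n ℕ.* n ℕ.^ p (i ℕ.+ suc r) ∎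
  where
  N = n ℕ.^ p (suc i ℕ.+ r)
  a T₁ T₀ : ℕ → ℕ
  a  j = (m ℕ.+ j) ℕ.^ p i
  T₁ j = a j ℕ.* Fgen p (suc i) (suc r) (suc (m ℕ.+ j)) n
  T₀ j = a j ℕ.* Fgen p (suc i) r (suc (m ℕ.+ j)) n
  split-inner : ∀ j → j < n ∸ m → a j ℕ.* Fgen p (suc i) (suc r) (suc (m ℕ.+ j)) (suc n) ≡ T₁ j ℕ.+ T₀ j ℕ.* N
  split-inner j j<n∸m = begin
    a j ℕ.* Fgen p (suc i) (suc r) (suc (m ℕ.+ j)) (suc n)
      ≡⟨ cong (a j ℕ.*_) (Fgen-last p (suc i) r (suc (m ℕ.+ j)) n (subst (_< n) (ℕP.+-comm j m) (m<o∸n⇒m+n<o j m n j<n∸m))) ⟩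
    a j ℕ.* (Fgen p (suc i) (suc r) (suc (m ℕ.+ j)) n ℕ.+ Fgen p (suc i) r (suc (m ℕ.+ j)) n ℕ.* N)
      ≡⟨ distribute (a j) _ _ N ⟩
    T₁ j ℕ.+ T₀ j ℕ.* N ∎
    where
    distribute : ∀ x u v w → x ℕ.* (u ℕ.+ v ℕ.* w) ≡ x ℕ.* u ℕ.+ x ℕ.* v ℕ.* w
    distribute = solve-∀

F-suc : ∀ p t n → F p (suc t) n ≡ σℕ (λ k → F p t k ℕ.* k ℕ.^ p (suc t)) n
F-suc p t zero    = refl
F-suc p t (suc n) = trans (Fgen-last p 1 t 0 n z≤n) (cong (ℕ._+ F p t n ℕ.* n ℕ.^ p (suc t)) (F-suc p t n))

toℚ-F-suc : ∀ p t n → toℚ (F p (suc t) n) ≡ σ (λ k → toℚ (F p t k) * toℚ k ^ℚ p (suc t)) n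
toℚ-F-suc p t n = begin
  toℚ (F p (suc t) n)                                   ≡⟨ cong toℚ (F-suc p t n) ⟩
  toℚ (σℕ (λ k → F p t k ℕ.* k ℕ.^ p (suc t)) n)        ≡⟨ toℚ-σℕ _ n ⟩
  σ (λ k → toℚ (F p t k ℕ.* k ℕ.^ p (suc t))) n         ≡⟨ σ-cong n cast ⟩
  σ (λ k → toℚ (F p t k) * toℚ k ^ℚ p (suc t)) n        ∎
  where
  cast : ∀ k → toℚ (F p t k ℕ.* k ℕ.^ p (suc t)) ≡ toℚ (F p t k) * toℚ k ^ℚ p (suc t)
  cast k = trans (toℚ-* (F p t k) (k ℕ.^ p (suc t))) (cong (toℚ (F p t k) *_) (toℚ-^ k (p (suc t))))

-- The polynomial

σ-polynomial*power : ∀ (s : ℕ → ℚ) e q n →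
  σ (λ k → σ (λ a → s a * toℚ k ^ℚ (e ∸ a)) e * toℚ k ^ℚ q) n
    ≡ σ (λ a → s a * faulhaber (e ℕ.+ q ℕ.+ 1 ∸ a) (toℚ n)) e
σ-polynomial*power s e q n = begin
  σ (λ k → σ (λ a → s a * toℚ k ^ℚ (e ∸ a)) e * toℚ k ^ℚ q) n
    ≡⟨ σ-cong n (λ k → sym (σ-*ʳ (toℚ k ^ℚ q) _ e)) ⟩
  σ (λ k → σ (λ a → s a * toℚ k ^ℚ (e ∸ a) * toℚ k ^ℚ q) e) n
    ≡⟨ σ-cong n (λ k → σ-cong e (λ a → merge-powers a (toℚ k))) ⟩
  σ (λ k → σ (λ a → s a * toℚ k ^ℚ ((e ∸ a) ℕ.+ q)) e) n
    ≡⟨ σ-comm _ e n ⟩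
  σ (λ a → σ (λ k → s a * toℚ k ^ℚ ((e ∸ a) ℕ.+ q)) n) e
    ≡⟨ σ-cong e (λ a → trans (σ-*ˡ (s a) _ n) (cong (s a *_) (sum-of-powers ((e ∸ a) ℕ.+ q) n))) ⟩
  σ (λ a → s a * faulhaber (suc ((e ∸ a) ℕ.+ q)) (toℚ n)) e
    ≡⟨ σ-cong-< e (λ a a<e → cong (λ E → s a * faulhaber E (toℚ n)) (sym (degree a (ℕP.<⇒≤ a<e)))) ⟩
  σ (λ a → s a * faulhaber (e ℕ.+ q ℕ.+ 1 ∸ a) (toℚ n)) e ∎
  where
  merge-powers : ∀ a y → s a * y ^ℚ (e ∸ a) * y ^ℚ q ≡ s a * y ^ℚ ((e ∸ a) ℕ.+ q)
  merge-powers a y = trans (*-assoc (s a) _ _) (cong (s a *_) (sym (^ℚ-+ y (e ∸ a) q)))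
  degree : ∀ a → a ≤ e → e ℕ.+ q ℕ.+ 1 ∸ a ≡ suc ((e ∸ a) ℕ.+ q)
  degree a a≤e = begin
    e ℕ.+ q ℕ.+ 1 ∸ a     ≡⟨ ℕP.+-∸-comm 1 (ℕP.≤-trans a≤e (ℕP.m≤m+n e q)) ⟩
    (e ℕ.+ q ∸ a) ℕ.+ 1   ≡⟨ cong (ℕ._+ 1) (ℕP.+-∸-comm q a≤e) ⟩
    (e ∸ a) ℕ.+ q ℕ.+ 1   ≡⟨ ℕP.+-comm _ 1 ⟩
    suc ((e ∸ a) ℕ.+ q)   ∎

Fpoly : (ℕ → ℕ) → ℕ → ℚ → ℚ
Fpoly p t x = σ (λ i → S p t i * x ^ℚ (d p t ∸ i)) (d p t)

term*power : ∀ p k a j x →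
  term p k a (a ℕ.+ j) * x ^ℚ (d p k ∸ (a ℕ.+ j)) ≡ faulhaberCoeff (d p k ∸ a) j * x ^ℚ (d p k ∸ a ∸ j)
term*power p k a j x =
  cong₂ (λ b e → faulhaberCoeff (d p k ∸ a) b * x ^ℚ e) (ℕP.m+n∸m≡n a j) (sym (ℕP.∸-+-assoc (d p k) a j))

Fpoly-suc : ∀ p k x →
  Fpoly p (suc (suc k)) x ≡ σ (λ a → S p (suc k) a * faulhaber (d p (suc (suc k)) ∸ a) x) (d p (suc k))
Fpoly-suc p k x = begin
  σ (λ i → σ (λ a → S′ a * term p (2 ℕ.+ k) a i) (suc (i ⊓ (d′ ∸ 1))) * x ^ℚ (D ∸ i)) D
    ≡⟨ σ-cong D (λ i → sym (σ-*ʳ (x ^ℚ (D ∸ i)) _ (suc (i ⊓ (d′ ∸ 1))))) ⟩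
  σ (λ i → σ (λ a → S′ a * term p (2 ℕ.+ k) a i * x ^ℚ (D ∸ i)) (suc (i ⊓ (d′ ∸ 1)))) D
    ≡⟨ σ-triangle (λ a i → S′ a * term p (2 ℕ.+ k) a i * x ^ℚ (D ∸ i)) (d′ ∸ 1) D ⟩
  σ (λ a → σ (λ j → S′ a * term p (2 ℕ.+ k) a (a ℕ.+ j) * x ^ℚ (D ∸ (a ℕ.+ j))) (D ∸ a)) (suc (d′ ∸ 1))
    ≡⟨ σ-cong (suc (d′ ∸ 1)) (λ a → trans (σ-cong (D ∸ a) (λ j → to-faulhaber a j)) (σ-*ˡ (S′ a) _ (D ∸ a))) ⟩
  σ (λ a → S′ a * faulhaber (D ∸ a) x) (suc (d′ ∸ 1))
    ≡⟨ cong (σ (λ a → S′ a * faulhaber (D ∸ a) x)) (trans (cong suc (ℕP.m+n∸n≡m (d p k ℕ.+ p (suc k)) 1)) (ℕP.+-comm 1 (d p k ℕ.+ p (suc k)))) ⟩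
  σ (λ a → S′ a * faulhaber (D ∸ a) x) d′ ∎
  where
  S′ = S p (suc k)
  d′ = d p (suc k)
  D  = d p (suc (suc k))
  to-faulhaber : ∀ a j → S′ a * term p (2 ℕ.+ k) a (a ℕ.+ j) * x ^ℚ (D ∸ (a ℕ.+ j))
                       ≡ S′ a * (faulhaberCoeff (D ∸ a) j * x ^ℚ (D ∸ a ∸ j))
  to-faulhaber a j = trans (*-assoc (S′ a) _ _) (cong (S′ a *_) (term*power p (2 ℕ.+ k) a j x))

F≡Fpoly : ∀ p t n → toℚ (F p (suc t) n) ≡ Fpoly p (suc t) (toℚ n)
F≡Fpoly p zero n = begin
  toℚ (F p 1 n)                   ≡⟨ toℚ-F-suc p 0 n ⟩
  σ (λ k → 1ℚ * toℚ k ^ℚ p 1) n   ≡⟨ σ-cong n (λ k → *-identityˡ (toℚ k ^ℚ p 1)) ⟩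
  σ (λ k → toℚ k ^ℚ p 1) n        ≡⟨ sum-of-powers (p 1) n ⟩
  faulhaber (suc (p 1)) (toℚ n)   ≡⟨ cong (λ E → faulhaber E (toℚ n)) (ℕP.+-comm 1 (p 1)) ⟩
  Fpoly p 1 (toℚ n)               ∎
F≡Fpoly p (suc k) n = begin
  toℚ (F p (2 ℕ.+ k) n)
    ≡⟨ toℚ-F-suc p (suc k) n ⟩
  σ (λ m → toℚ (F p (suc k) m) * toℚ m ^ℚ p (2 ℕ.+ k)) n
    ≡⟨ σ-cong n (λ m → cong (_* toℚ m ^ℚ p (2 ℕ.+ k)) (F≡Fpoly p k m)) ⟩
  σ (λ m → Fpoly p (suc k) (toℚ m) * toℚ m ^ℚ p (2 ℕ.+ k)) n
    ≡⟨ σ-polynomial*power (S p (suc k)) (d p (suc k)) (p (2 ℕ.+ k)) n ⟩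
  σ (λ a → S p (suc k) a * faulhaber (d p (2 ℕ.+ k) ∸ a) (toℚ n)) (d p (suc k))
    ≡⟨ sym (Fpoly-suc p k (toℚ n)) ⟩
  Fpoly p (2 ℕ.+ k) (toℚ n) ∎

term-pos : ∀ p k → Positive (term p (suc k) 0 0)
term-pos p k = subst Positive (sym (trans (*-identityˡ (inv (d p (suc k)))) (cong inv (ℕP.+-comm M 1)))) (inv-pos M)
  where M = d p k ℕ.+ p (suc k)

S-leading-pos : ∀ p t → Positive (S p (suc t) 0)
S-leading-pos p zero    = term-pos p 0
S-leading-pos p (suc t) = subst Positive (sym (+-identityˡ (S p (suc t) 0 * term p (2 ℕ.+ t) 0 0)))
  (pos*pos⇒pos (S p (suc t) 0) {{S-leading-pos p t}} (term p (2 ℕ.+ t) 0 0) {{term-pos p (suc t)}})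

evalPoly-reversed : ∀ (c : ℕ → ℚ) D x → c 0 ≡ 0ℚ → evalPoly c D x ≡ σ (λ i → c (D ∸ i) * x ^ℚ (D ∸ i)) D
evalPoly-reversed c D x c0≡0 = begin
  σ (λ k → c k * x ^ℚ k) (suc D)                     ≡⟨ σ-head (λ k → c k * x ^ℚ k) D ⟩
  c 0 * 1ℚ + σ (λ k → c (suc k) * x ^ℚ suc k) D       ≡⟨ cong (_+ σ (λ k → c (suc k) * x ^ℚ suc k) D) constant-term ⟩
  0ℚ + σ (λ k → c (suc k) * x ^ℚ suc k) D             ≡⟨ +-identityˡ _ ⟩
  σ (λ k → c (suc k) * x ^ℚ suc k) D                  ≡⟨ σ-reverse (λ k → c (suc k) * x ^ℚ suc k) D ⟩
  σ (λ i → c (suc (D ∸ suc i)) * x ^ℚ suc (D ∸ suc i)) D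
    ≡⟨ σ-cong-< D (λ i i<D → cong (λ e → c e * x ^ℚ e) (sym (ℕP.+-∸-assoc 1 i<D))) ⟩
  σ (λ i → c (D ∸ i) * x ^ℚ (D ∸ i)) D                ∎
  where
  constant-term : c 0 * 1ℚ ≡ 0ℚ
  constant-term = trans (*-identityʳ (c 0)) c0≡0

proposition2 : (t : ℕ) → 1 ≤ t → (p : ℕ → ℕ) → (∀ i → 1 ≤ i → i ≤ t → 1 ≤ p i) →
    Σ (ℕ → ℚ) (λ c →
      c (d p t) ≢ 0ℚ
      × c 0 ≡ 0ℚ
      × (∀ n → toℚ (F p t n) ≡ evalPoly c (d p t) (toℚ n))
      × (∀ i → i < d p t → c (d p t ∸ i) ≡ S p t i))
proposition2 (suc t) _ p _ = c , leading≢0 , refl , agrees , coefficient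
  where
  D = d p (suc t)
  c : ℕ → ℚ
  c zero    = 0ℚ
  c (suc k) = S p (suc t) (D ∸ suc k)   -- evalPoly c D never reads c beyond D
  coefficient : ∀ i → i < D → c (D ∸ i) ≡ S p (suc t) i
  coefficient i i<D = trans (c-positive (D ∸ i) (ℕP.m<n⇒0<n∸m i<D)) (cong (S p (suc t)) (ℕP.m∸[m∸n]≡n (ℕP.<⇒≤ i<D)))
    where
    c-positive : ∀ k → 0 < k → c k ≡ S p (suc t) (D ∸ k)
    c-positive (suc k) _ = refl
  leading≢0 : c D ≢ 0ℚ
  leading≢0 c[D]≡0 = <-irrefl (sym (trans (sym (coefficient 0 0<D)) c[D]≡0)) (positive⁻¹ _ {{S-leading-pos p t}})
    where 0<D = subst (0 <_) (ℕP.+-comm 1 (d p t ℕ.+ p (suc t))) (s≤s z≤n)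
  agrees : ∀ n → toℚ (F p (suc t) n) ≡ evalPoly c D (toℚ n)
  agrees n = begin
    toℚ (F p (suc t) n)                                  ≡⟨ F≡Fpoly p t n ⟩
    Fpoly p (suc t) (toℚ n)                              ≡⟨ σ-cong-< D (λ i i<D → cong (_* toℚ n ^ℚ (D ∸ i)) (sym (coefficient i i<D))) ⟩
    σ (λ i → c (D ∸ i) * toℚ n ^ℚ (D ∸ i)) D             ≡⟨ sym (evalPoly-reversed c D (toℚ n) refl) ⟩
    evalPoly c D (toℚ n)                                 ∎
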